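{- There is an absolute constant $c>0$ such that for every connected finite simple graph $G=(V,E)$ with at least one edge and $n=|V|$ vertices, given by its vertex set and adjacency list, the Enter-Exit Greedy Algorithm (EEGA) on $G$ terminates after at most $c\,n^3$ primitive computational steps; that is, its worst-case running time is $O(n^3)$.
   Context: Primitive computational steps: assigning a value to a variable, appending an element to the end of a list, reading an element from a list, and an arithmetic operation on numbers. Notation: $N(x)$ is the neighbourhood of $x$, $d_x=|N(x)|$, and $d_x(A)=|N(x)\cap A|$ for $A\subseteq V$. The EEGA on input $G$ is: Phase 1. Compute all degrees and order the vertices as $x_1,\dots,x_n$ with $d_{x_1}\ge\dots\ge d_{x_n}$; set $d_i=d_{x_i}$; let $L$ be the smallest positive integer with $d_1+\dots+d_L\ge |E|$; return $L$. Phase 2. Set $S=\{x_1,\dots,x_L\}$. (Entry loop) While there is $x\in V\setminus S$ with $d_x(V\setminus S)>0$, take the first such $x$ in the ordering and move it from $V\setminus S$ into $S$. (Exit loop) Then, while there is $y\in S$ with $d_y(V\setminus S)=0$, take the last such $y$ in the ordering and move it from $S$ into $V\setminus S$. (Final step) If $d_x(S)=0$ for every $x\in S$, set $U=\min\{|S|,n-|S|\}$, otherwise $U=|S|$; test whether $G$ is bipartite, and if it is, with bipartition $V=A\cup B$, replace $U$ by $\min\{U,|A|,|B|\}$. Return $U$. -}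

module Defs where

open import Level using (Level)
open import Data.Nat using (ℕ; zero; suc; _+_; _*_; _∸_; _⊓_; _<ᵇ_; _≤ᵇ_; _≡ᵇ_; _/_)
open import Data.Bool using (Bool; true; false; if_then_else_; not; _∧_; _xor_)
open import Relation.Binary.PropositionalEquality using (_≡_; refl)
open import Data.Maybe using (Maybe; just; nothing)
open import Data.Product using (_×_; _,_; Σ)
open import Data.Unit using (⊤; tt)
open import Data.Fin using (Fin; zero; suc)
open import Data.Vec using (Vec; lookup; replicate; _[_]≔_)
open import Data.List using (List; []; _∷_; allFin)
open import Data.List.Membership.Propositional using (_∈_)
open import Data.List.Relation.Unary.Unique.Propositional using (Unique)
open import Relation.Nullary using (¬_)

Adj : ℕ → Set
Adj n = Vec (List (Fin n)) n

IsSimple : {n : ℕ} → Adj n → Set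
IsSimple {n} adj =
  ((x : Fin n) → ¬ (x ∈ lookup adj x)) ×
  ((x : Fin n) → Unique (lookup adj x)) ×
  ((x y : Fin n) → y ∈ lookup adj x → x ∈ lookup adj y)

data Reach {n : ℕ} (adj : Adj n) (x : Fin n) : Fin n → Set where
  here : Reach adj x x
  step : {y z : Fin n} → Reach adj x y → z ∈ lookup adj y → Reach adj x z

Connected : {n : ℕ} → Adj n → Set
Connected {n} adj = (x y : Fin n) → Reach adj x y

HasEdge : {n : ℕ} → Adj n → Set
HasEdge {n} adj = Σ (Fin n) λ x → Σ (Fin n) λ y → y ∈ lookup adj x

-- Step-counting computations: M A runs with a budget of primitive steps;
-- each primitive step (tick) consumes one unit; running out of budget
-- yields nothing.  So  run budget ≡ just _  means "terminates within
-- budget primitive steps".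

M : Set → Set
M A = ℕ → Maybe (A × ℕ)

pure : {A : Set} → A → M A
pure a k = just (a , k)

_>>=_ : {A B : Set} → M A → (A → M B) → M B
(m >>= f) k with m k
... | nothing       = nothing
... | just (a , k') = f a k'

_>>_ : {A B : Set} → M A → M B → M B
m >> m' = m >>= λ _ → m'

infixl 1 _>>=_ _>>_

tick : M ⊤
tick zero    = nothing
tick (suc k) = just (tt , k)

read : {A : Set} {n : ℕ} → Vec A n → Fin n → M A
read v i = do tick ; pure (lookup v i)

write : {A : Set} {n : ℕ} → Vec A n → Fin n → A → M (Vec A n)
write v i a = do tick ; pure (v [ i ]≔ a)

arith : {A : Set} → A → M A
arith a = do tick ; pure a

foldM : {A B : Set} → (B → A → M B) → B → List A → M B
foldM f b []       = pure b
foldM f b (a ∷ as) = do tick ; b' ← f b a ; foldM f b' as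

findFirst : {A : Set} → (A → M Bool) → List A → M (Maybe A)
findFirst p []       = pure nothing
findFirst p (a ∷ as) = do
  tick
  b ← p a
  if b then pure (just a) else findFirst p as

-- Each iteration costs at least one step, so the iteration counter
-- (initialised to the remaining budget) never runs out before the budget.
whileAux : {S : Set} → ℕ → (S → M (Maybe S)) → S → M S
whileAux zero    f s = λ _ → nothing
whileAux (suc i) f s = do
  tick
  r ← f s
  continue r
  where
  continue : Maybe _ → M _
  continue nothing   = pure s
  continue (just s') = whileAux i f s'

while : {S : Set} → (S → M (Maybe S)) → S → M S
while f s k = whileAux k f s k

newArray : {A : Set} (n : ℕ) → A → M (Vec A n)
newArray n a = do
  foldM (λ _ _ → tick) tt (allFin n)
  pure (replicate n a)

module EEGA {n : ℕ} (adj : Adj n) where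

  vertices : List (Fin n)
  vertices = allFin n

  degree : Fin n → M ℕ
  degree x = do
    l ← read adj x
    foldM (λ c _ → arith (suc c)) 0 l

  degrees : M (Vec ℕ n)
  degrees = do
    d0 ← newArray n 0
    foldM (λ d x → do dx ← degree x ; write d x dx) d0 vertices

  insert : Vec ℕ n → Fin n → List (Fin n) → M (List (Fin n))
  insert d x []       = do tick ; pure (x ∷ [])
  insert d x (y ∷ ys) = do
    tick
    dx ← read d x
    dy ← read d y
    b ← arith (dy <ᵇ dx)
    if b then (do tick ; pure (x ∷ y ∷ ys))
         else (do r ← insert d x ys ; tick ; pure (y ∷ r))

  ordering : Vec ℕ n → M (List (Fin n))
  ordering d = foldM (λ o x → insert d x o) [] vertices

  -- smallest positive L with d_1 + ... + d_L ≥ m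
  findL : Vec ℕ n → ℕ → ℕ → ℕ → List (Fin n) → M ℕ
  findL d m acc cnt []       = pure cnt
  findL d m acc cnt (x ∷ xs) = do
    tick
    dx ← read d x
    acc' ← arith (acc + dx)
    cnt' ← arith (suc cnt)
    b ← arith (m ≤ᵇ acc')
    if b then pure cnt' else findL d m acc' cnt' xs

  markFirst : ℕ → List (Fin n) → Vec Bool n → M (Vec Bool n)
  markFirst zero    _        s = pure s
  markFirst (suc l) []       s = pure s
  markFirst (suc l) (x ∷ xs) s = do
    tick
    _ ← arith l
    s' ← write s x true
    markFirst l xs s'

  -- number of neighbours y of x with (y ∈ S) = b ;  b = false gives d_x(V∖S)
  dCount : Vec Bool n → Bool → Fin n → M ℕ
  dCount s b x = do
    l ← read adj x
    foldM (λ c y → do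
             v ← read s y
             e ← arith (if v then b else not b)
             if e then arith (suc c) else pure c) 0 l

  entryStep : List (Fin n) → Vec Bool n → M (Maybe (Vec Bool n))
  entryStep order s = do
    r ← findFirst test order
    go r
    where
    test : Fin n → M Bool
    test x = do
      v ← read s x
      if v then pure false
           else (do dx ← dCount s false x ; arith (0 <ᵇ dx))
    go : Maybe (Fin n) → M (Maybe (Vec Bool n))
    go nothing  = pure nothing
    go (just x) = do s' ← write s x true ; pure (just s')

  -- scanning the reversed ordering finds the LAST such y in the ordering
  exitStep : List (Fin n) → Vec Bool n → M (Maybe (Vec Bool n))
  exitStep revOrder s = do
    r ← findFirst test revOrder
    go r
    where
    test : Fin n → M Bool
    test y = do
      v ← read s y
      if v then (do dy ← dCount s false y ; arith (dy ≡ᵇ 0))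
           else pure false
    go : Maybe (Fin n) → M (Maybe (Vec Bool n))
    go nothing  = pure nothing
    go (just y) = do s' ← write s y false ; pure (just s')

  sizeS : Vec Bool n → M ℕ
  sizeS s = foldM (λ c x → do v ← read s x ; if v then arith (suc c) else pure c) 0 vertices

  independent : Vec Bool n → M Bool
  independent s = foldM (λ ok x → do
      v ← read s x
      if v then (do dx ← dCount s true x ; z ← arith (dx ≡ᵇ 0) ; arith (ok ∧ z))
           else pure ok) true vertices

  colourRound : Vec (Maybe Bool) n → M (Vec (Maybe Bool) n)
  colourRound col = foldM cstep col vertices
    where
    cstep : Vec (Maybe Bool) n → Fin n → M (Vec (Maybe Bool) n)
    cstep c x = do
      cx ← read c x
      stepC cx
      where
      stepC : Maybe Bool → M (Vec (Maybe Bool) n)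
      stepC nothing  = pure c
      stepC (just b) = do
        l ← read adj x
        foldM (λ c' y → do
                 cy ← read c' y
                 upd c' y cy) c l
        where
        upd : Vec (Maybe Bool) n → Fin n → Maybe Bool → M (Vec (Maybe Bool) n)
        upd c' y nothing  = write c' y (just (not b))
        upd c' y (just _) = pure c'

  rounds : ℕ → Vec (Maybe Bool) n → M (Vec (Maybe Bool) n)
  rounds zero    c = pure c
  rounds (suc r) c = do tick ; c' ← colourRound c ; rounds r c'

  proper : Vec (Maybe Bool) n → M Bool
  proper col = foldM (λ ok x → do
      cx ← read col x
      l ← read adj x
      foldM (λ ok' y → do
               cy ← read col y
               good ← arith (check cx cy)
               arith (ok' ∧ good)) ok l) true vertices
    where
    check : Maybe Bool → Maybe Bool → Bool
    check (just a) (just b) = a xor b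
    check _ _ = false

  countTrue : Vec (Maybe Bool) n → M ℕ
  countTrue col = foldM (λ c x → do
      cx ← read col x
      isT cx c) 0 vertices
    where
    isT : Maybe Bool → ℕ → M ℕ
    isT (just true) c = arith (suc c)
    isT _           c = pure c

  -- bipartiteness test (G connected): 2-colour from a start vertex by
  -- n propagation rounds; returns just (|A| , |B|) if bipartite
  bipartition : M (Maybe (ℕ × ℕ))
  bipartition = start n refl-n
    where
    refl-n : n ≡ n
    refl-n = refl
    start : (k : ℕ) → k ≡ n → M (Maybe (ℕ × ℕ))
    start zero    _    = pure (just (0 , 0))
    start (suc k) refl = do
      c0 ← newArray n nothing
      c1 ← write c0 zero (just false)
      c  ← rounds n c1
      ok ← proper c
      if ok then (do a ← countTrue c ; b ← arith (n ∸ a) ; pure (just (a , b)))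
            else pure nothing

  phase1 : M (ℕ × List (Fin n))
  phase1 = do
    d ← degrees
    order ← ordering d
    total ← foldM (λ t x → do dx ← read d x ; arith (t + dx)) 0 vertices
    m ← arith (total / 2)        -- |E| = (sum of degrees) / 2
    L ← findL d m 0 0 order
    pure (L , order)

  phase2 : ℕ → List (Fin n) → M ℕ
  phase2 L order = do
    s0 ← newArray n false
    s1 ← markFirst L order s0
    s2 ← while (entryStep order) s1
    revOrder ← foldM (λ r x → arith (x ∷ r)) [] order
    s3 ← while (exitStep revOrder) s2
    k ← sizeS s3
    ind ← independent s3
    U0 ← (if ind then (do nk ← arith (n ∸ k) ; arith (k ⊓ nk)) else pure k)
    bp ← bipartition
    final U0 bp
    where
    final : ℕ → Maybe (ℕ × ℕ) → M ℕ
    final U0 nothing        = pure U0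
    final U0 (just (a , b)) = do u ← arith (U0 ⊓ a) ; arith (u ⊓ b)

  run : M (ℕ × ℕ)
  run = do
    (L , order) ← phase1
    U ← phase2 L order
    pure (L , U)

eega : {n : ℕ} → Adj n → M (ℕ × ℕ)
eega adj = EEGA.run adj

TerminatesWithin : {n : ℕ} → Adj n → ℕ → Set
TerminatesWithin adj b = Σ ((ℕ × ℕ) × ℕ) λ r → eega adj b ≡ just r

module Submission where

-- Each procedure of the EEGA nests at most three loops of at most n + 1 iterations each:
-- loops over the vertices, over a neighbour list (at most n entries, as it has no
-- repetitions), over the n rounds of the 2-colouring, and the entry and exit loops,
-- which stop within n + 1 iterations because each iteration moves one vertex into,
-- respectively out of, S.  Counting costs as k·(n+1)^j, the whole run costs at most
-- 86·(n+1)³, which is at most 688·n³ once n ≥ 1.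

open import Defs
open import Data.Bool using (Bool; true; false; if_then_else_; not; T)
open import Data.Bool.Properties using (_≟_)
open import Data.Empty using (⊥-elim)
open import Data.Fin using (Fin; zero; suc)
open import Data.Fin.Properties using (injective⇒≤)
open import Data.List as List using (List; []; _∷_; length)
open import Data.List.Membership.Propositional.Properties using (∈-lookup)
open import Data.List.Properties using (length-tabulate)
open import Data.List.Relation.Unary.All as All using ()
open import Data.List.Relation.Unary.Unique.Propositional using (Unique; _∷_)
open import Data.Maybe using (Maybe; just; nothing)
open import Data.Maybe.Relation.Unary.All as Maybe using (just; nothing)
open import Data.Nat
  using (ℕ; zero; suc; _+_; _*_; _^_; _∸_; _≤_; _<_; z≤n; s≤s; s≤s⁻¹; _≤ᵇ_; _<ᵇ_; _/_)
open import Data.Nat.Induction using (<-wellFounded)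
open import Data.Nat.Properties
  using ( ≤-refl; ≤-reflexive; ≤-trans; module ≤-Reasoning; m≤m+n; m≤n+m; n≤1+n; m≤n⇒m≤1+n
        ; +-assoc; +-comm; +-suc; +-identityʳ; +-mono-≤; +-monoˡ-≤; m+[n∸m]≡n
        ; *-assoc; *-comm; *-identityʳ; *-distribʳ-+; *-monoˡ-≤; *-monoʳ-≤; ^-monoˡ-≤; ^-monoʳ-≤)
open import Data.Nat.Tactic.RingSolver using (solve-∀)
open import Data.Product using (Σ; _×_; _,_)
open import Data.Unit using (⊤; tt)
open import Data.Vec using (Vec; []; _∷_; lookup; _[_]≔_; count)
open import Data.Vec.Properties using (count≤n)
open import Function using (id)
open import Induction.WellFounded using (Acc; acc)
open import Relation.Binary.PropositionalEquality using (_≡_; refl; sym; trans; cong; module ≡-Reasoning)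
open import Relation.Nullary using (does)

-- Costs are exact and independent of the budget: given steps + k units, m returns the
-- same result and leaves exactly k.  An upper bound would not suffice for `while`,
-- whose iteration counter is the budget itself.
record Within {A : Set} (m : M A) (c : ℕ) (P : A → Set) : Set where
  constructor within
  field
    steps  : ℕ
    steps≤ : steps ≤ c
    result : A
    valid  : P result
    runs   : ∀ k → m (steps + k) ≡ just (result , k)

>>=-just : {A B : Set} {m : M A} {f : A → M B} {k k′ : ℕ} {a : A} →
           m k ≡ just (a , k′) → (m >>= f) k ≡ f a k′
>>=-just eq rewrite eq = refl

within-pure : {A : Set} (a : A) → Within (pure a) 0 (_≡ a)
within-pure a = within 0 z≤n a refl (λ _ → refl)

within-tick : Within tick 1 (λ _ → ⊤)
within-tick = within 1 ≤-refl tt tt (λ _ → refl)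

within->>= : {A B : Set} {m : M A} {f : A → M B} {c d : ℕ} {P : A → Set} {Q : B → Set} →
             Within m c P → (∀ a → P a → Within (f a) d Q) → Within (m >>= f) (c + d) Q
within->>= {m = m} {f} (within u u≤c a pa m-runs) hf with hf a pa
... | within v v≤d b qb f-runs = within (u + v) (+-mono-≤ u≤c v≤d) b qb λ k → begin
  (m >>= f) (u + v + k)   ≡⟨ cong (m >>= f) (+-assoc u v k) ⟩
  (m >>= f) (u + (v + k)) ≡⟨ >>=-just {m = m} {f = f} (m-runs (v + k)) ⟩
  f a (v + k)             ≡⟨ f-runs k ⟩
  just (b , k)            ∎
  where open ≡-Reasoning

within-weaken : {A : Set} {m : M A} {c c′ : ℕ} {P : A → Set} → c ≤ c′ → Within m c P → Within m c′ P
within-weaken c≤c′ (within u u≤c a pa runs) = within u (≤-trans u≤c c≤c′) a pa runs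

within-map : {A : Set} {m : M A} {c : ℕ} {P Q : A → Set} → (∀ a → P a → Q a) → Within m c P → Within m c Q
within-map f (within u u≤c a pa runs) = within u u≤c a (f a pa) runs

within-if : {A : Set} {m₁ m₂ : M A} {c : ℕ} {P : A → Set} (b : Bool) →
            Within m₁ c P → Within m₂ c P → Within (if b then m₁ else m₂) c P
within-if true  w₁ w₂ = w₁
within-if false w₁ w₂ = w₂

within-terminates : {A : Set} {m : M A} {c : ℕ} {P : A → Set} → Within m c P → Σ (A × ℕ) λ r → m c ≡ just r
within-terminates {m = m} {c} (within u u≤c a _ runs) =
  (a , c ∸ u) , trans (cong m (sym (m+[n∸m]≡n u≤c))) (runs (c ∸ u))

within-read : {A : Set} {n : ℕ} (v : Vec A n) (i : Fin n) → Within (read v i) 1 (_≡ lookup v i)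
within-read v i = within->>= within-tick λ _ _ → within-pure (lookup v i)

within-write : {A : Set} {n : ℕ} (v : Vec A n) (i : Fin n) (a : A) →
               Within (write v i a) 1 (_≡ v [ i ]≔ a)
within-write v i a = within->>= within-tick λ _ _ → within-pure (v [ i ]≔ a)

within-arith : {A : Set} (a : A) → Within (arith a) 1 (_≡ a)
within-arith a = within->>= within-tick λ _ _ → within-pure a

within-foldM : {A B : Set} {f : B → A → M B} {d : ℕ} (I : B → List A → Set) →
               (∀ b a as → I b (a ∷ as) → Within (f b a) d (λ b′ → I b′ as)) →
               (as : List A) (b : B) → I b as →
               Within (foldM f b as) (length as * suc d) (λ b′ → I b′ [])
within-foldM I body []       b ib = within-map (λ { _ refl → ib }) (within-pure b)
within-foldM I body (a ∷ as) b ib =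
  within->>= within-tick λ _ _ →
  within->>= (body b a as ib) λ b′ ib′ →
  within-foldM I body as b′ ib′

within-findFirst : {A : Set} {p : A → M Bool} {d : ℕ} {Q : A → Set} →
                   (∀ a → Within (p a) d (λ b → T b → Q a)) → (as : List A) →
                   Within (findFirst p as) (length as * suc d) (Maybe.All Q)
within-findFirst test []       = within-map (λ { _ refl → nothing }) (within-pure nothing)
within-findFirst test (a ∷ as) =
  within->>= within-tick λ _ _ →
  within->>= (test a) λ
    { true  qa → within-weaken z≤n (within-map (λ { _ refl → just (qa tt) }) (within-pure (just a)))
    ; false _  → within-findFirst test as }

module _ {S : Set} (f : S → M (Maybe S)) (μ : S → ℕ) {c : ℕ}
         (body : ∀ s → Within (f s) c (Maybe.All (λ s′ → μ s′ < μ s))) where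

  private
    record Iterates (s : S) : Set where
      field
        steps  : ℕ
        steps≤ : steps ≤ suc (μ s) * suc c
        final  : S
        runs   : ∀ i k → steps ≤ i → whileAux i f s (steps + k) ≡ just (final , k)

    iterate : ∀ s → Acc _<_ (μ s) → Iterates s
    iterate s (acc rec) with body s
    ... | within v v≤c nothing _ f-runs = record
      { steps  = suc v
      ; steps≤ = s≤s (≤-trans v≤c (m≤m+n c _))
      ; final  = s
      ; runs   = λ { (suc i) k _ → >>=-just {m = f s} (f-runs k) }
      }
    ... | within v v≤c (just s′) (just μs′<μs) f-runs with iterate s′ (rec μs′<μs)
    ... | record { steps = w ; steps≤ = w≤ ; final = s∞ ; runs = loop-runs } = record
      { steps  = suc (v + w)
      ; steps≤ = s≤s (+-mono-≤ v≤c (≤-trans w≤ (*-monoˡ-≤ (suc c) μs′<μs)))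
      ; final  = s∞
      ; runs   = λ { (suc i) k v+w<i →
          trans (>>=-just {m = f s} (trans (cong (f s) (+-assoc v w k)) (f-runs (w + k))))
                (loop-runs i k (≤-trans (m≤n+m w v) (s≤s⁻¹ v+w<i))) }
      }

  within-while : ∀ s → Within (while f s) (suc (μ s) * suc c) (λ _ → ⊤)
  within-while s = within steps steps≤ final tt (λ k → runs (steps + k) k (m≤m+n steps k))
    where open Iterates (iterate s (<-wellFounded (μ s)))

count-[]≔-< : ∀ {n} b (s : Vec Bool n) (x : Fin n) → lookup s x ≡ b →
              count (_≟ b) (s [ x ]≔ not b) < count (_≟ b) s
count-[]≔-< true  (true ∷ s)  zero    refl = ≤-refl
count-[]≔-< false (false ∷ s) zero    refl = ≤-refl
count-[]≔-< b     (y ∷ s)     (suc x) eq with does (y ≟ b)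
... | true  = s≤s (count-[]≔-< b s x eq)
... | false = count-[]≔-< b s x eq

Unique-lookup-injective : {A : Set} {xs : List A} → Unique xs →
                          ∀ {i j} → List.lookup xs i ≡ List.lookup xs j → i ≡ j
Unique-lookup-injective (x∉xs ∷ u) {zero}  {zero}  _  = refl
Unique-lookup-injective (x∉xs ∷ u) {zero}  {suc j} eq = ⊥-elim (All.lookup x∉xs (∈-lookup j) eq)
Unique-lookup-injective (x∉xs ∷ u) {suc i} {zero}  eq = ⊥-elim (All.lookup x∉xs (∈-lookup i) (sym eq))
Unique-lookup-injective (x∉xs ∷ u) {suc i} {suc j} eq = cong suc (Unique-lookup-injective u eq)

Unique⇒length≤ : ∀ {n} {xs : List (Fin n)} → Unique xs → length xs ≤ n
Unique⇒length≤ {xs = xs} u = injective⇒≤ {f = List.lookup xs} (Unique-lookup-injective u)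

module PowerCosts (n : ℕ) where

  -- n + 1 rather than n: a while loop whose measure is at most n iterates at most n + 1 times.
  N : ℕ
  N = suc n

  record Costs {A : Set} (m : M A) (k j : ℕ) (P : A → Set) : Set where
    constructor costs
    field toWithin : Within m (k * N ^ j) P
  open Costs public

  1≤N^j : ∀ j → 1 ≤ N ^ j
  1≤N^j j = ^-monoʳ-≤ N {0} {j} z≤n

  loop-bound : ∀ {a} k j → a ≤ N → a * suc (k * N ^ j) ≤ suc k * N ^ suc j
  loop-bound {a} k j a≤N = begin
    a * suc (k * X)          ≤⟨ *-monoˡ-≤ (suc (k * X)) a≤N ⟩
    N * suc (k * X)          ≤⟨ *-monoʳ-≤ N (+-monoˡ-≤ (k * X) (1≤N^j j)) ⟩
    N * (X + k * X)          ≡⟨ distribute N X k ⟩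
    N * X + k * (N * X)      ∎
    where
    open ≤-Reasoning
    X : ℕ
    X = N ^ j
    distribute : ∀ N X k → N * (X + k * X) ≡ N * X + k * (N * X)
    distribute = solve-∀

  costs-linear : {A : Set} {m : M A} {a : ℕ} (k : ℕ) {P : A → Set} →
                 a ≤ N → Within m (a * k) P → Costs m k 1 P
  costs-linear {a = a} k a≤N w = costs (within-weaken a*k≤k*N w)
    where
    a*k≤k*N : a * k ≤ k * N ^ 1
    a*k≤k*N = begin
      a * k      ≤⟨ *-monoˡ-≤ k a≤N ⟩
      N * k      ≡⟨ *-comm N k ⟩
      k * N      ≡⟨ cong (k *_) (sym (*-identityʳ N)) ⟩
      k * N ^ 1  ∎
      where open ≤-Reasoning

  costs->>= : {A B : Set} {m : M A} {f : A → M B} {k₁ k₂ j : ℕ} {P : A → Set} {Q : B → Set} →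
              Costs m k₁ j P → (∀ a → P a → Costs (f a) k₂ j Q) → Costs (m >>= f) (k₁ + k₂) j Q
  costs->>= {k₁ = k₁} {k₂} {j} (costs w) cf =
    costs (within-weaken (≤-reflexive (sym (*-distribʳ-+ (N ^ j) k₁ k₂)))
                         (within->>= w λ a pa → toWithin (cf a pa)))

  costs-weaken : {A : Set} {m : M A} {k k′ j : ℕ} {P : A → Set} → k ≤ k′ → Costs m k j P → Costs m k′ j P
  costs-weaken {j = j} k≤k′ (costs w) = costs (within-weaken (*-monoˡ-≤ (N ^ j) k≤k′) w)

  costs-raise : {A : Set} {m : M A} {k j j′ : ℕ} {P : A → Set} → j ≤ j′ → Costs m k j P → Costs m k j′ P
  costs-raise {k = k} j≤j′ (costs w) = costs (within-weaken (*-monoʳ-≤ k (^-monoʳ-≤ N j≤j′)) w)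

  costs-const : {A : Set} {m : M A} {c j : ℕ} {P : A → Set} → Within m c P → Costs m c j P
  costs-const {c = c} {j} w =
    costs (within-weaken (≤-trans (≤-reflexive (sym (*-identityʳ c))) (*-monoʳ-≤ c (1≤N^j j))) w)

  costs-map : {A : Set} {m : M A} {k j : ℕ} {P Q : A → Set} → (∀ a → P a → Q a) → Costs m k j P → Costs m k j Q
  costs-map f (costs w) = costs (within-map f w)

  costs-if : {A : Set} {m₁ m₂ : M A} {k j : ℕ} {P : A → Set} (b : Bool) →
             Costs m₁ k j P → Costs m₂ k j P → Costs (if b then m₁ else m₂) k j P
  costs-if true  c₁ c₂ = c₁
  costs-if false c₁ c₂ = c₂

  costs-pure : {A : Set} {j : ℕ} (a : A) → Costs (pure a) 0 j (_≡ a)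
  costs-pure a = costs (within-pure a)

  costs-forget : {A : Set} {m : M A} {k j : ℕ} {P : A → Set} → Costs m k j P → Costs m k j (λ _ → ⊤)
  costs-forget = costs-map (λ _ _ → tt)

  costs-return : {A : Set} {k j : ℕ} (a : A) → Costs (pure a) k j (λ _ → ⊤)
  costs-return a = costs-weaken z≤n (costs-forget (costs-pure a))

  costs-tick : {j : ℕ} → Costs tick 1 j (λ _ → ⊤)
  costs-tick = costs-const within-tick

  costs-read : {A : Set} {m j : ℕ} (v : Vec A m) (i : Fin m) → Costs (read v i) 1 j (_≡ lookup v i)
  costs-read v i = costs-const (within-read v i)

  costs-write : {A : Set} {m j : ℕ} (v : Vec A m) (i : Fin m) (a : A) →
                Costs (write v i a) 1 j (_≡ v [ i ]≔ a)
  costs-write v i a = costs-const (within-write v i a)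

  costs-arith : {A : Set} {j : ℕ} (a : A) → Costs (arith a) 1 j (_≡ a)
  costs-arith a = costs-const (within-arith a)

  costs-foldM-with : {A B : Set} {f : B → A → M B} {k j : ℕ} (I : B → List A → Set) →
                     (∀ b a as → I b (a ∷ as) → Costs (f b a) k j (λ b′ → I b′ as)) →
                     (as : List A) → length as ≤ n → (b : B) → I b as →
                     Costs (foldM f b as) (suc k) (suc j) (λ b′ → I b′ [])
  costs-foldM-with {k = k} {j} I body as len≤n b ib =
    costs (within-weaken (loop-bound k j (m≤n⇒m≤1+n len≤n))
                         (within-foldM I (λ b a as ib → toWithin (body b a as ib)) as b ib))

  costs-foldM : {A B : Set} {f : B → A → M B} {k j : ℕ} {I : B → Set} →
                (∀ b a → I b → Costs (f b a) k j I) →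
                (as : List A) → length as ≤ n → (b : B) → I b →
                Costs (foldM f b as) (suc k) (suc j) I
  costs-foldM {I = I} body = costs-foldM-with (λ b _ → I b) (λ b a _ → body b a)

  costs-findFirst : {A : Set} {p : A → M Bool} {k j : ℕ} {Q : A → Set} →
                    (∀ a → Costs (p a) k j (λ b → T b → Q a)) →
                    (as : List A) → length as ≤ n →
                    Costs (findFirst p as) (suc k) (suc j) (Maybe.All Q)
  costs-findFirst {k = k} {j} test as len≤n =
    costs (within-weaken (loop-bound k j (m≤n⇒m≤1+n len≤n))
                         (within-findFirst (λ a → toWithin (test a)) as))

  costs-while : {S : Set} (f : S → M (Maybe S)) (μ : S → ℕ) {k j : ℕ} → (∀ s → μ s ≤ n) →
                (∀ s → Costs (f s) k j (Maybe.All (λ s′ → μ s′ < μ s))) →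
                ∀ s → Costs (while f s) (suc k) (suc j) (λ _ → ⊤)
  costs-while f μ {k} {j} μ≤n body s =
    costs (within-weaken (loop-bound k j (s≤s (μ≤n s)))
                         (within-while f μ (λ s → toWithin (body s)) s))

-- The vertex count is a successor so that `bipartition`, defined by matching on it, unfolds.
module EEGA-Costs (m : ℕ) (adj : Adj (suc m)) (deg≤ : ∀ x → length (lookup adj x) ≤ suc m) where

  n : ℕ
  n = suc m

  open PowerCosts n
  open EEGA adj

  length-vertices : length vertices ≡ n
  length-vertices = length-tabulate id

  vertices≤ : length vertices ≤ n
  vertices≤ = ≤-reflexive length-vertices

  degree-costs : ∀ x → Costs (degree x) 3 1 (λ _ → ⊤)
  degree-costs x = costs->>= (costs-read adj x) λ { l refl →
    costs-foldM (λ c _ _ → costs-forget (costs-arith {j = 0} (suc c))) l (deg≤ x) 0 tt }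

  newArray-costs : {A : Set} (a : A) → Costs (newArray n a) 2 1 (λ _ → ⊤)
  newArray-costs a =
    costs->>= (costs-foldM (λ _ _ _ → costs-tick {j = 0}) vertices vertices≤ tt tt) λ _ _ →
    costs-return _

  degrees-costs : Costs degrees 7 2 (λ _ → ⊤)
  degrees-costs =
    costs->>= (costs-raise (s≤s z≤n) (newArray-costs 0)) λ d₀ _ →
    costs-foldM (λ d x _ → costs->>= (degree-costs x) λ dx _ → costs-forget (costs-write d x dx))
                vertices vertices≤ d₀ tt

  insert-within : ∀ (d : Vec ℕ n) x ys →
                  Within (insert d x ys) (suc (length ys) * 5) (λ r → length r ≡ suc (length ys))
  insert-within d x [] =
    within-weaken (s≤s z≤n)
      (within-map (λ { _ refl → refl }) (within->>= within-tick λ _ _ → within-pure (x ∷ [])))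
  insert-within d x (y ∷ ys) =
    within-weaken (≤-reflexive (cong (4 +_) (+-comm (suc (length ys) * 5) 1)))
    (within->>= within-tick λ _ _ →
     within->>= (within-read d x) λ dx _ →
     within->>= (within-read d y) λ dy _ →
     within->>= (within-arith (dy <ᵇ dx)) λ b _ →
     within-if b
       (within-weaken (m≤n+m 1 (suc (length ys) * 5))
         (within-map (λ { _ refl → refl }) (within->>= within-tick λ _ _ → within-pure (x ∷ y ∷ ys))))
       (within->>= (insert-within d x ys) λ r |r| →
        within->>= within-tick λ _ _ →
        within-map (λ { _ refl → cong suc |r| }) (within-pure (y ∷ r))))

  ordering-costs : ∀ d → Costs (ordering d) 6 2 (λ o → length o ≡ n)
  ordering-costs d =
    costs-map (λ o eq → trans (sym (+-identityʳ (length o))) eq)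
      (costs-foldM-with (λ o xs → length o + length xs ≡ n) inserts vertices vertices≤ [] length-vertices)
    where
    inserts : ∀ o x xs → length o + suc (length xs) ≡ n →
              Costs (insert d x o) 5 1 (λ o′ → length o′ + length xs ≡ n)
    inserts o x xs eq =
      costs-map (λ o′ |o′| → trans (cong (_+ length xs) |o′|) (trans (sym (+-suc (length o) (length xs))) eq))
        (costs-linear 5 (s≤s (≤-trans (m≤m+n (length o) _) (≤-reflexive eq))) (insert-within d x o))

  findL-within : ∀ (d : Vec ℕ n) total sum ℓ xs → Within (findL d total sum ℓ xs) (length xs * 5) (λ _ → ⊤)
  findL-within d total sum ℓ [] = within-map (λ _ _ → tt) (within-pure ℓ)
  findL-within d total sum ℓ (x ∷ xs) =
    within->>= within-tick λ _ _ →
    within->>= (within-read d x) λ dx _ →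
    within->>= (within-arith (sum + dx)) λ sum′ _ →
    within->>= (within-arith (suc ℓ)) λ ℓ′ _ →
    within->>= (within-arith (total ≤ᵇ sum′)) λ b _ →
    within-if b (within-weaken z≤n (within-map (λ _ _ → tt) (within-pure ℓ′)))
                (findL-within d total sum′ ℓ′ xs)

  degree-sum-costs : ∀ (d : Vec ℕ n) →
    Costs (foldM (λ t x → do dx ← read d x ; arith (t + dx)) 0 vertices) 3 1 (λ _ → ⊤)
  degree-sum-costs d =
    costs-foldM (λ t x _ → costs->>= (costs-read d x) λ dx _ → costs-forget (costs-arith (t + dx)))
                vertices vertices≤ 0 tt

  phase1-costs : Costs phase1 22 2 (λ (_ , order) → length order ≡ n)
  phase1-costs =
    costs->>= degrees-costs λ d _ →
    costs->>= (ordering-costs d) λ order |order| →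
    costs->>= (costs-raise (s≤s z≤n) (degree-sum-costs d)) λ total _ →
    costs->>= (costs-arith (total / 2)) λ edges _ →
    costs->>= (costs-raise (s≤s z≤n)
                 (costs-linear 5 (m≤n⇒m≤1+n (≤-reflexive |order|)) (findL-within d edges 0 0 order))) λ L _ →
    costs-map (λ { _ refl → |order| }) (costs-pure (L , order))

  markFirst-within : ∀ l xs s → Within (markFirst l xs s) (length xs * 3) (λ _ → ⊤)
  markFirst-within zero    xs       s = within-weaken z≤n (within-map (λ _ _ → tt) (within-pure s))
  markFirst-within (suc l) []       s = within-map (λ _ _ → tt) (within-pure s)
  markFirst-within (suc l) (x ∷ xs) s =
    within->>= within-tick λ _ _ →
    within->>= (within-arith l) λ _ _ →
    within->>= (within-write s x true) λ s′ _ →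
    markFirst-within l xs s′

  dCount-costs : ∀ s b x → Costs (dCount s b x) 5 1 (λ _ → ⊤)
  dCount-costs s b x = costs->>= (costs-read adj x) λ { l refl →
    costs-foldM (λ c y _ →
      costs->>= (costs-read {j = 0} s y) λ v _ →
      costs->>= (costs-arith (if v then b else not b)) λ e _ →
      costs-if e (costs-forget (costs-arith (suc c))) (costs-return c))
      l (deg≤ x) 0 tt }

  outside : Vec Bool n → ℕ
  outside = count (_≟ false)

  inside : Vec Bool n → ℕ
  inside = count (_≟ true)

  entryStep-costs : ∀ order → length order ≤ n → ∀ s →
    Costs (entryStep order s) 9 2 (Maybe.All (λ s′ → outside s′ < outside s))
  entryStep-costs order order≤ s = costs->>= (costs-findFirst test order order≤) move
    where
    test : ∀ x → Costs _ 7 1 (λ b → T b → lookup s x ≡ false)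
    test x = costs->>= (costs-read s x) λ
      { true  _    → costs-weaken z≤n (costs-map (λ { _ refl () }) (costs-pure false))
      ; false sx≡v → costs->>= (dCount-costs s false x) λ _ _ →
                     costs-map (λ _ _ _ → sym sx≡v) (costs-arith _) }
    move : ∀ r → Maybe.All (λ x → lookup s x ≡ false) r → Costs _ 1 2 _
    move nothing  _            = costs-weaken z≤n (costs-map (λ { _ refl → nothing }) (costs-pure nothing))
    move (just x) (just sx≡false) = costs->>= (costs-write s x true) λ { _ refl →
      costs-map (λ { _ refl → just (count-[]≔-< false s x sx≡false) }) (costs-pure _) }

  exitStep-costs : ∀ order → length order ≤ n → ∀ s →
    Costs (exitStep order s) 9 2 (Maybe.All (λ s′ → inside s′ < inside s))
  exitStep-costs order order≤ s = costs->>= (costs-findFirst test order order≤) move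
    where
    test : ∀ x → Costs _ 7 1 (λ b → T b → lookup s x ≡ true)
    test x = costs->>= (costs-read s x) λ
      { false _    → costs-weaken z≤n (costs-map (λ { _ refl () }) (costs-pure false))
      ; true  sx≡v → costs->>= (dCount-costs s false x) λ _ _ →
                     costs-map (λ _ _ _ → sym sx≡v) (costs-arith _) }
    move : ∀ r → Maybe.All (λ x → lookup s x ≡ true) r → Costs _ 1 2 _
    move nothing  _            = costs-weaken z≤n (costs-map (λ { _ refl → nothing }) (costs-pure nothing))
    move (just x) (just sx≡true) = costs->>= (costs-write s x false) λ { _ refl →
      costs-map (λ { _ refl → just (count-[]≔-< true s x sx≡true) }) (costs-pure _) }

  reverse-costs : ∀ (order : List (Fin n)) → length order ≤ n →
    Costs (foldM (λ r x → arith (x ∷ r)) [] order) 2 1 (λ r → length r ≤ n)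
  reverse-costs order order≤ =
    costs-map (λ r eq → ≤-trans (≤-reflexive (trans (sym (+-identityʳ (length r))) eq)) order≤)
      (costs-foldM-with (λ r xs → length r + length xs ≡ length order) prepend order order≤ [] refl)
    where
    prepend : ∀ r x xs → length r + suc (length xs) ≡ length order →
              Costs (arith (x ∷ r)) 1 0 (λ r′ → length r′ + length xs ≡ length order)
    prepend r x xs eq = costs-map (λ { _ refl → trans (sym (+-suc (length r) (length xs))) eq }) (costs-arith _)

  sizeS-costs : ∀ s → Costs (sizeS s) 3 1 (λ _ → ⊤)
  sizeS-costs s = costs-foldM (λ c x _ →
      costs->>= (costs-read {j = 0} s x) λ v _ →
      costs-if v (costs-forget (costs-arith (suc c))) (costs-return c))
    vertices vertices≤ 0 tt

  independent-costs : ∀ s → Costs (independent s) 9 2 (λ _ → ⊤)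
  independent-costs s = costs-foldM (λ ok x _ →
      costs->>= (costs-read s x) λ v _ →
      costs-if v (costs->>= (dCount-costs s true x) λ _ _ →
                  costs->>= (costs-arith _) λ _ _ →
                  costs-forget (costs-arith _))
                 (costs-return ok))
    vertices vertices≤ true tt

  colourRound-costs : ∀ col → Costs (colourRound col) 6 2 (λ _ → ⊤)
  colourRound-costs col = costs-foldM (λ c x _ →
      costs->>= (costs-read c x) λ
      { nothing  _ → costs-return c
      ; (just b) _ → costs->>= (costs-read adj x) λ { l refl →
          costs-foldM (λ c′ y _ → costs->>= (costs-read {j = 0} c′ y) λ
            { nothing  _ → costs-forget (costs-write c′ y _)
            ; (just _) _ → costs-return c′ })
          l (deg≤ x) c tt } })
    vertices vertices≤ col tt

  rounds-within : ∀ r col → Within (rounds r col) (r * suc (6 * N ^ 2)) (λ _ → ⊤)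
  rounds-within zero    col = within-map (λ _ _ → tt) (within-pure col)
  rounds-within (suc r) col =
    within->>= within-tick λ _ _ →
    within->>= (toWithin (colourRound-costs col)) λ col′ _ →
    rounds-within r col′

  rounds-costs : ∀ col → Costs (rounds n col) 7 3 (λ _ → ⊤)
  rounds-costs col = costs (within-weaken (loop-bound 6 2 (n≤1+n n)) (rounds-within n col))

  proper-costs : ∀ col → Costs (proper col) 7 2 (λ _ → ⊤)
  proper-costs col = costs-foldM (λ ok x _ →
      costs->>= (costs-read col x) λ _ _ →
      costs->>= (costs-read adj x) λ { l refl →
      costs-foldM (λ ok′ y _ →
        costs->>= (costs-read {j = 0} col y) λ _ _ →
        costs->>= (costs-arith _) λ _ _ →
        costs-forget (costs-arith _))
        l (deg≤ x) ok tt })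
    vertices vertices≤ true tt

  countTrue-costs : ∀ col → Costs (countTrue col) 3 1 (λ _ → ⊤)
  countTrue-costs col = costs-foldM (λ c x _ →
      costs->>= (costs-read {j = 0} col x) λ
      { (just true)  _ → costs-forget (costs-arith _)
      ; (just false) _ → costs-return c
      ; nothing      _ → costs-return c })
    vertices vertices≤ 0 tt

  bipartition-costs : Costs bipartition 21 3 (λ _ → ⊤)
  bipartition-costs =
    costs->>= (costs-raise (s≤s z≤n) (newArray-costs nothing)) λ c₀ _ →
    costs->>= (costs-write c₀ zero (just false)) λ c₁ _ →
    costs->>= (rounds-costs c₁) λ col _ →
    costs->>= (costs-raise (s≤s (s≤s z≤n)) (proper-costs col)) λ ok _ →
    costs-if ok (costs-raise (s≤s z≤n) (costs->>= (countTrue-costs col) λ _ _ →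
                                        costs->>= (costs-arith _) λ _ _ →
                                        costs-return _))
                (costs-return _)

  phase2-costs : ∀ L order → length order ≤ n → Costs (phase2 L order) 64 3 (λ _ → ⊤)
  phase2-costs L order order≤ =
    costs->>= (costs-raise (s≤s z≤n) (newArray-costs false)) λ s₀ _ →
    costs->>= (costs-raise (s≤s z≤n) (costs-linear 3 (m≤n⇒m≤1+n order≤) (markFirst-within L order s₀))) λ s₁ _ →
    costs->>= (costs-while (entryStep order) outside (count≤n (_≟ false)) (entryStep-costs order order≤) s₁) λ s₂ _ →
    costs->>= (costs-raise (s≤s z≤n) (reverse-costs order order≤)) λ revOrder revOrder≤ →
    costs->>= (costs-while (exitStep revOrder) inside (count≤n (_≟ true)) (exitStep-costs revOrder revOrder≤) s₂) λ s₃ _ →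
    costs->>= (costs-raise (s≤s z≤n) (sizeS-costs s₃)) λ k _ →
    costs->>= (costs-raise (s≤s (s≤s z≤n)) (independent-costs s₃)) λ ind _ →
    costs->>= {k₁ = 2} (costs-if ind (costs->>= (costs-arith _) λ _ _ → costs-forget (costs-arith _))
                                     (costs-return k)) λ U₀ _ →
    costs->>= bipartition-costs λ bp _ → final U₀ bp
    where
    final : ∀ U₀ bp → Costs _ 2 3 (λ _ → ⊤)
    final U₀ nothing        = costs-return U₀
    final U₀ (just (a , b)) = costs->>= (costs-arith _) λ _ _ → costs-forget (costs-arith _)

  run-costs : Costs run 86 3 (λ _ → ⊤)
  run-costs =
    costs->>= (costs-raise (s≤s (s≤s z≤n)) phase1-costs) λ (L , order) |order| →
    costs->>= (phase2-costs L order (≤-reflexive |order|)) λ _ _ →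
    costs-return _

suc-cube≤ : ∀ m → suc (suc m) ^ 3 ≤ 8 * suc m ^ 3
suc-cube≤ m = begin
  suc (suc m) ^ 3      ≤⟨ ^-monoˡ-≤ 3 (+-monoˡ-≤ (suc m) (s≤s (z≤n {m}))) ⟩
  (suc m + suc m) ^ 3  ≡⟨ double-cube (suc m) ⟩
  8 * suc m ^ 3        ∎
  where
  open ≤-Reasoning
  double-cube : ∀ k → (k + k) * ((k + k) * ((k + k) * 1)) ≡ 8 * (k * (k * (k * 1)))
  double-cube = solve-∀

mainTheorem14 : Σ ℕ λ c → (0 < c) ×
    ((n : ℕ) (adj : Adj n) → IsSimple adj → Connected adj → HasEdge adj →
      TerminatesWithin adj (c * n ^ 3))
mainTheorem14 = 688 , s≤s z≤n , eega-cubic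
  where
  eega-cubic : (n : ℕ) (adj : Adj n) → IsSimple adj → Connected adj → HasEdge adj →
               TerminatesWithin adj (688 * n ^ 3)
  eega-cubic zero    adj _                       _ (() , _)
  eega-cubic (suc m) adj (_ , neighbours-unique , _) _ _ =
    within-terminates (within-weaken 86N³≤688n³ (PowerCosts.toWithin (EEGA-Costs.run-costs m adj deg≤)))
    where
    deg≤ : ∀ x → length (lookup adj x) ≤ suc m
    deg≤ x = Unique⇒length≤ (neighbours-unique x)
    86N³≤688n³ : 86 * suc (suc m) ^ 3 ≤ 688 * suc m ^ 3
    86N³≤688n³ = ≤-trans (*-monoʳ-≤ 86 (suc-cube≤ m)) (≤-reflexive (sym (*-assoc 86 8 (suc m ^ 3))))
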